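{- Let $\epsilon>0$, let $G=(V,E,\ell:E\to[L])$ be a graph with $n$ vertices and terminals $U\subseteq V$, and let $H=(U,E_H,\ell_H:E_H\to[2nL])$ be a graph (possibly with parallel edges) such that: (1) for each vertex $x\in V$ there is a unique terminal $t_x\in U$ assigned to $x$, where $t_x$ is a $(1+\epsilon)$-closest terminal to $x$; and (2) for each edge $(x,y)\in E$ there exists an edge $(t_x,t_y)\in E_H$ of length at most $(1+\epsilon)\cdot(d_G(t_x,x)+\ell(x,y)+d_G(y,t_y))$. Then the minimum spanning tree of $H$ has length at most $2(1+\epsilon)^{2}$ times the length of a minimum $U$-Steiner tree of $G$.
   Context: $G$ is undirected, $[L]=\{1,\ldots,L\}$, and $d_G$ denotes shortest-path distance with respect to $\ell$. A terminal $t_x\in U$ is a $(1+\epsilon)$-closest terminal to $x$ if $d_G(x,t_x)\le(1+\epsilon)\,d_G(x,t)$ for all $t\in U$. A $U$-Steiner tree of $G$ is a subtree of $G$ containing all vertices of $U$; its length is the sum of $\ell$ over its edges.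
   Formalization: The parameter ε ranges only over the positive rationals. -}

module Defs where

open import Data.Nat as ℕ using (ℕ; zero; suc)
open import Data.Fin using (Fin; zero; suc)
open import Data.Fin.Subset using (Subset; _∈_; ∣_∣; inside; outside)
open import Data.Vec using (_∷_; [])
open import Data.Product using (_×_; _,_; proj₁; proj₂)
open import Data.Sum using (_⊎_)
open import Data.Integer using (+_)
open import Data.Rational using (ℚ; _/_)
open import Relation.Binary.PropositionalEquality using (_≡_; _≢_)

-- An undirected multigraph on vertex set Fin k with m edges.
-- Edge i joins the two endpoints in  edge i  (unordered) and has length  len i.
record Graph (k : ℕ) : Set where
  field
    m    : ℕ
    edge : Fin m → Fin k × Fin k
    len  : Fin m → ℕ
open Graph public

Joins : ∀ {k} (g : Graph k) → Fin (m g) → Fin k → Fin k → Set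
Joins g i x z = (edge g i ≡ (x , z)) ⊎ (edge g i ≡ (z , x))

Simple : ∀ {k} → Graph k → Set
Simple g = (∀ i → proj₁ (edge g i) ≢ proj₂ (edge g i))
         × (∀ i j x y → Joins g i x y → Joins g j x y → i ≡ j)

-- Walks in g from x to y of total length d (shortest-path distance d_G(x,y)
-- is the infimum of such d).
data WalkLen {k} (g : Graph k) : Fin k → Fin k → ℕ → Set where
  nil  : ∀ {x} → WalkLen g x x 0
  cons : ∀ {x z y d} (i : Fin (m g)) → Joins g i x z → WalkLen g z y d →
         WalkLen g x y (len g i ℕ.+ d)

data Conn {k} (g : Graph k) (S : Subset (m g)) : Fin k → Fin k → Set where
  here : ∀ {x} → Conn g S x x
  step : ∀ {x z y} (i : Fin (m g)) → i ∈ S → Joins g i x z → Conn g S z y →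
         Conn g S x y

-- A subtree of g with edge set S and vertex set Vs, containing all vertices of W:
-- S's edges have endpoints in Vs, W ⊆ Vs, (Vs,S) connected, and |S| + 1 = |Vs|
-- (a connected graph is a tree iff it has one fewer edge than vertices).
IsSubtree : ∀ {k} (g : Graph k) (W : Subset k) (S : Subset (m g)) (Vs : Subset k) → Set
IsSubtree g W S Vs =
    (∀ i → i ∈ S → (proj₁ (edge g i) ∈ Vs) × (proj₂ (edge g i) ∈ Vs))
  × (∀ x → x ∈ W → x ∈ Vs)
  × (∀ x y → x ∈ Vs → y ∈ Vs → Conn g S x y)
  × (suc ∣ S ∣ ≡ ∣ Vs ∣)

weight' : ∀ {m} → (Fin m → ℕ) → Subset m → ℕ
weight' f [] = 0
weight' f (inside ∷ S)  = f zero ℕ.+ weight' (λ i → f (suc i)) S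
weight' f (outside ∷ S) = weight' (λ i → f (suc i)) S

weight : ∀ {k} (g : Graph k) → Subset (m g) → ℕ
weight g S = weight' (len g) S

IsMinSteinerTree : ∀ {k} (g : Graph k) (U : Subset k) (S : Subset (m g)) (Vs : Subset k) → Set
IsMinSteinerTree g U S Vs =
  IsSubtree g U S Vs ×
  (∀ S' Vs' → IsSubtree g U S' Vs' → weight g S ℕ.≤ weight g S')

-- Minimum spanning tree of a graph h whose vertex set is U (h lives on Fin k but
-- all its edges have endpoints in U): a subtree with vertex set exactly U.
IsMST : ∀ {k} (h : Graph k) (U : Subset k) (T : Subset (m h)) → Set
IsMST h U T =
  IsSubtree h U T U ×
  (∀ T' → IsSubtree h U T' U → weight h T ℕ.≤ weight h T')

ℕ→ℚ : ℕ → ℚ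
ℕ→ℚ n = (+ n) / 1

-- Double the Steiner tree S into a closed walk of length at most 2·w(S) through every terminal
-- and cut it at the terminals into terminal-to-terminal walks. For an edge (x, y) of G on such a
-- walk of length D, d(x, t x) is at most (1+ε) times the distance from x back to the walk's first
-- terminal, and likewise for y and its last terminal, so the H-edge between t x and t y has
-- length at most (1+ε)²·D; by the cycle property the MST joins t x and t y through edges no
-- longer than that. So the ends of every piece are joined in the MST by edges of length at most
-- (1+ε)² times the piece's length, and an exchange argument (contract an MST edge crossing the
-- cut left by deleting one piece) charges the MST edges to distinct pieces.

module Submission where

open import Defs
open import Data.Nat as ℕ using (ℕ; zero; suc)
import Data.Nat.Properties as ℕP
open import Data.Integer as ℤ using (+_)
import Data.Integer.Properties as ℤP
open import Data.Nat.Coprimality using (1-coprimeTo) renaming (sym to coprime-sym)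
open import Data.Rational using (ℚ; _≤_; _<_; _+_; _*_; 0ℚ; 1ℚ; mkℚ; *≤*; NonNegative; nonNegative; toℚᵘ)
import Data.Rational.Properties as ℚP
import Data.Rational.Unnormalised as ℚᵘ
import Data.Rational.Unnormalised.Properties as ℚᵘP
open import Data.Fin as Fin using (Fin; zero; suc)
import Data.Fin.Properties as FinP
open import Data.Fin.Subset
  using (Subset; _⊆_; _∈_; _∉_; ∣_∣; inside; outside; ⊥; ⊤; ⁅_⁆; _∪_; _∩_; _─_; _-_; Nonempty)
open import Data.Fin.Subset.Properties
  using ( _∈?_; ∈⊤; p─q⊆p; p─⊥≡p; x∈p∧x≢y⇒x∈p-y; x∈p∧x∉q⇒x∈p─q; ∣p─q∣≤∣p∣; x∈p∩q⁺; x∈p∩q⁻; ∣p∩q∣≤∣p∣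
        ; x∈p∪q⁺; p⊆p∪q; ∪-identityʳ; x∈⁅x⁆; x∈⁅y⁆⇒x≡y; ∣⁅x⁆∣≡1; ∣⊥∣≡0; p⊆q⇒∣p∣≤∣q∣; nonempty?; Empty-unique)
open import Data.Vec using ([]; _∷_; here; there)
open import Data.Product using (_×_; _,_; proj₁; proj₂; ∃-syntax; Σ-syntax)
open import Data.Sum as Sum using (_⊎_; inj₁; inj₂)
open import Relation.Nullary using (¬_; Dec; yes; no; does; contradiction)
open import Relation.Unary using (Decidable)
open import Relation.Nullary.Decidable using (_×-dec_; _⊎-dec_)
open import Data.Nat.Solver using (module +-*-Solver)
open import Algebra.Properties.CommutativeSemigroup ℕP.+-commutativeSemigroup using (x∙yz≈y∙xz; xy∙z≈zy∙x)
open import Data.List as List using (List; []; _∷_)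
open import Data.Nat.ListAction using (sum)
open import Function using (_∘_)
open import Relation.Binary.Construct.Closure.ReflexiveTransitive as Star using (Star; ε; _◅_; _◅◅_)
open import Relation.Binary.PropositionalEquality
  using (_≡_; _≢_; refl; cong; cong₂; sym; trans; subst; subst₂; module ≡-Reasoning)

ℕ→ℚ≡mkℚ : ∀ n → ℕ→ℚ n ≡ mkℚ (+ n) 0 (coprime-sym (1-coprimeTo n))
ℕ→ℚ≡mkℚ n = ℚP.normalize-coprime (coprime-sym (1-coprimeTo n))

ℕ→ℚ-mono-≤ : ∀ {a b} → a ℕ.≤ b → ℕ→ℚ a ≤ ℕ→ℚ b
ℕ→ℚ-mono-≤ {a} {b} a≤b rewrite ℕ→ℚ≡mkℚ a | ℕ→ℚ≡mkℚ b =
  *≤* (subst₂ ℤ._≤_ (sym (ℤP.*-identityʳ (+ a))) (sym (ℤP.*-identityʳ (+ b))) (ℤ.+≤+ a≤b))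

ℕ→ℚ-cancel-≤ : ∀ {a b} → ℕ→ℚ a ≤ ℕ→ℚ b → a ℕ.≤ b
ℕ→ℚ-cancel-≤ {a} {b} a≤b rewrite ℕ→ℚ≡mkℚ a | ℕ→ℚ≡mkℚ b with a≤b
... | *≤* a≤b′ with subst₂ ℤ._≤_ (ℤP.*-identityʳ (+ a)) (ℤP.*-identityʳ (+ b)) a≤b′
...   | ℤ.+≤+ a≤b″ = a≤b″

ℕ→ℚ-homo-+ : ∀ a b → ℕ→ℚ (a ℕ.+ b) ≡ ℕ→ℚ a + ℕ→ℚ b
ℕ→ℚ-homo-+ a b =
  ℚP.toℚᵘ-injective (ℚᵘP.≃-trans embed (ℚᵘP.≃-sym (ℚP.toℚᵘ-homo-+ (ℕ→ℚ a) (ℕ→ℚ b))))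
  where
  embed : toℚᵘ (ℕ→ℚ (a ℕ.+ b)) ℚᵘ.≃ (toℚᵘ (ℕ→ℚ a) ℚᵘ.+ toℚᵘ (ℕ→ℚ b))
  embed rewrite ℕ→ℚ≡mkℚ (a ℕ.+ b) | ℕ→ℚ≡mkℚ a | ℕ→ℚ≡mkℚ b = ℚᵘ.*≡* (begin
    + (a ℕ.+ b) ℤ.* + 1                   ≡⟨ ℤP.*-identityʳ _ ⟩
    + a ℤ.+ + b                           ≡⟨ cong₂ ℤ._+_ (sym (ℤP.*-identityʳ (+ a))) (sym (ℤP.*-identityʳ (+ b))) ⟩
    + a ℤ.* + 1 ℤ.+ + b ℤ.* + 1           ≡⟨ sym (ℤP.*-identityʳ _) ⟩
    (+ a ℤ.* + 1 ℤ.+ + b ℤ.* + 1) ℤ.* + 1 ∎)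
    where open ≡-Reasoning

ℕ→ℚ-nonNeg : ∀ n → NonNegative (ℕ→ℚ n)
ℕ→ℚ-nonNeg n rewrite ℕ→ℚ≡mkℚ n = _

infix 4 _≤[_]_

_≤[_]_ : ℕ → ℚ → ℕ → Set
a ≤[ c ] b = ℕ→ℚ a ≤ c * ℕ→ℚ b

≤[]-monoˡ : ∀ {c a a′ b} → a ℕ.≤ a′ → a′ ≤[ c ] b → a ≤[ c ] b
≤[]-monoˡ a≤a′ a′≤cb = ℚP.≤-trans (ℕ→ℚ-mono-≤ a≤a′) a′≤cb

module _ (c : ℚ) {{c≥0 : NonNegative c}} where

  ≤[]-monoʳ : ∀ {a b b′} → a ≤[ c ] b → b ℕ.≤ b′ → a ≤[ c ] b′
  ≤[]-monoʳ a≤cb b≤b′ = ℚP.≤-trans a≤cb (ℚP.*-monoˡ-≤-nonNeg c (ℕ→ℚ-mono-≤ b≤b′))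

  0≤[] : ∀ b → 0 ≤[ c ] b
  0≤[] b = ℚP.nonNegative⁻¹ (c * ℕ→ℚ b) {{ℚP.nonNeg*nonNeg⇒nonNeg c (ℕ→ℚ b) {{ℕ→ℚ-nonNeg b}}}}

  ≤[]-+ : ∀ {a a′ b b′} → a ≤[ c ] b → a′ ≤[ c ] b′ → a ℕ.+ a′ ≤[ c ] b ℕ.+ b′
  ≤[]-+ {a} {a′} {b} {b′} a≤cb a′≤cb′
    rewrite ℕ→ℚ-homo-+ a a′ | ℕ→ℚ-homo-+ b b′ | ℚP.*-distribˡ-+ c (ℕ→ℚ b) (ℕ→ℚ b′) =
    ℚP.+-mono-≤ a≤cb a′≤cb′

≤[]-double : ∀ c a b → a ≤[ c ] b ℕ.+ b → ℕ→ℚ a ≤ ℕ→ℚ 2 * c * ℕ→ℚ b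
≤[]-double c a b = subst (ℕ→ℚ a ≤_) (begin
  c * ℕ→ℚ (b ℕ.+ b)             ≡⟨ cong (c *_) (ℕ→ℚ-homo-+ b b) ⟩
  c * (ℕ→ℚ b + ℕ→ℚ b)           ≡⟨ ℚP.*-distribˡ-+ c (ℕ→ℚ b) (ℕ→ℚ b) ⟩
  c * ℕ→ℚ b + c * ℕ→ℚ b         ≡⟨ sym (ℚP.*-distribʳ-+ (ℕ→ℚ b) c c) ⟩
  (c + c) * ℕ→ℚ b               ≡⟨ cong (λ x → (x + x) * ℕ→ℚ b) (sym (ℚP.*-identityˡ c)) ⟩
  (1ℚ * c + 1ℚ * c) * ℕ→ℚ b     ≡⟨ cong (_* ℕ→ℚ b) (sym (ℚP.*-distribʳ-+ c 1ℚ 1ℚ)) ⟩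
  ℕ→ℚ 2 * c * ℕ→ℚ b             ∎)
  where open ≡-Reasoning

module _ (e : ℚ) (1≤e : 1ℚ ≤ e) where

  private instance
    e≥0 : NonNegative e
    e≥0 = nonNegative (ℚP.≤-trans (ℚP.nonNegative⁻¹ 1ℚ) 1≤e)

  n≤[]n : ∀ n → n ≤[ e ] n
  n≤[]n n = subst (_≤ e * ℕ→ℚ n) (ℚP.*-identityˡ (ℕ→ℚ n))
              (ℚP.*-monoʳ-≤-nonNeg (ℕ→ℚ n) {{ℕ→ℚ-nonNeg n}} 1≤e)

  ≤[]-detour : ∀ {a₁ a₂ l p s b} → a₁ ≤[ e ] p → a₂ ≤[ e ] s →
               b ≤[ e ] a₁ ℕ.+ l ℕ.+ a₂ → b ≤[ e * e ] p ℕ.+ (l ℕ.+ s)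
  ≤[]-detour {a₁} {a₂} {l} {p} {s} {b} a₁≤ep a₂≤es b≤e[a₁+l+a₂] =
    ℚP.≤-trans b≤e[a₁+l+a₂] (subst (e * ℕ→ℚ (a₁ ℕ.+ l ℕ.+ a₂) ≤_) (sym e²[p+l+s])
      (ℚP.*-monoˡ-≤-nonNeg e
        (≤[]-+ e {a₁ ℕ.+ l} {a₂} {p ℕ.+ l} {s} (≤[]-+ e {a₁} {l} {p} {l} a₁≤ep (n≤[]n l)) a₂≤es)))
    where
    open ≡-Reasoning
    e²[p+l+s] : (e * e) * ℕ→ℚ (p ℕ.+ (l ℕ.+ s)) ≡ e * (e * ℕ→ℚ (p ℕ.+ l ℕ.+ s))
    e²[p+l+s] = begin
      (e * e) * ℕ→ℚ (p ℕ.+ (l ℕ.+ s)) ≡⟨ ℚP.*-assoc e e _ ⟩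
      e * (e * ℕ→ℚ (p ℕ.+ (l ℕ.+ s))) ≡⟨ cong (λ x → e * (e * ℕ→ℚ x)) (sym (ℕP.+-assoc p l s)) ⟩
      e * (e * ℕ→ℚ (p ℕ.+ l ℕ.+ s))   ∎

x∉p-x : ∀ {n} (p : Subset n) x → x ∉ p - x
x∉p-x (b ∷ p) zero ()
x∉p-x (b ∷ p) (suc x) (there x∈p-x) = x∉p-x p x x∈p-x

x∈p-y⇒x≢y : ∀ {n} {p : Subset n} {x y} → x ∈ p - y → x ≢ y
x∈p-y⇒x≢y x∈p-x refl = x∉p-x _ _ x∈p-x

x∈p⇒∣p∣≡1+∣p-x∣ : ∀ {n} {p : Subset n} {x} → x ∈ p → ∣ p ∣ ≡ suc ∣ p - x ∣
x∈p⇒∣p∣≡1+∣p-x∣ {p = inside ∷ p} {x = zero} here = cong (suc ∘ ∣_∣) (sym (p─⊥≡p p))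
x∈p⇒∣p∣≡1+∣p-x∣ {p = inside ∷ p} {x = suc x} (there x∈p) = cong suc (x∈p⇒∣p∣≡1+∣p-x∣ x∈p)
x∈p⇒∣p∣≡1+∣p-x∣ {p = outside ∷ p} {x = suc x} (there x∈p) = x∈p⇒∣p∣≡1+∣p-x∣ x∈p

∣p∣≡1+k⇒∣p-x∣≡k : ∀ {n} {p : Subset n} {x k} → x ∈ p → ∣ p ∣ ≡ suc k → ∣ p - x ∣ ≡ k
∣p∣≡1+k⇒∣p-x∣≡k x∈p ∣p∣≡1+k = ℕP.suc-injective (trans (sym (x∈p⇒∣p∣≡1+∣p-x∣ x∈p)) ∣p∣≡1+k)

x∉p⇒p∪⁅x⁆-x≡p : ∀ {n} {p : Subset n} {x} → x ∉ p → (p ∪ ⁅ x ⁆) - x ≡ p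
x∉p⇒p∪⁅x⁆-x≡p {p = inside ∷ p} {x = zero} x∉p = contradiction here x∉p
x∉p⇒p∪⁅x⁆-x≡p {p = outside ∷ p} {x = zero} _ = cong (outside ∷_) (trans (p─⊥≡p (p ∪ ⊥)) (∪-identityʳ p))
x∉p⇒p∪⁅x⁆-x≡p {p = inside ∷ p} {x = suc x} x∉p = cong (inside ∷_) (x∉p⇒p∪⁅x⁆-x≡p (x∉p ∘ there))
x∉p⇒p∪⁅x⁆-x≡p {p = outside ∷ p} {x = suc x} x∉p = cong (outside ∷_) (x∉p⇒p∪⁅x⁆-x≡p (x∉p ∘ there))

x∈p∪⁅x⁆ : ∀ {n} (p : Subset n) x → x ∈ p ∪ ⁅ x ⁆
x∈p∪⁅x⁆ p x = x∈p∪q⁺ (inj₂ (x∈⁅x⁆ x))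

x∉p⇒∣p∪⁅x⁆∣≡1+∣p∣ : ∀ {n} {p : Subset n} {x} → x ∉ p → ∣ p ∪ ⁅ x ⁆ ∣ ≡ suc ∣ p ∣
x∉p⇒∣p∪⁅x⁆∣≡1+∣p∣ {p = p} {x} x∉p =
  trans (x∈p⇒∣p∣≡1+∣p-x∣ (x∈p∪⁅x⁆ p x)) (cong (suc ∘ ∣_∣) (x∉p⇒p∪⁅x⁆-x≡p x∉p))

∣p∣≡1+k⇒Nonempty : ∀ {n} {p : Subset n} {k} → ∣ p ∣ ≡ suc k → Nonempty p
∣p∣≡1+k⇒Nonempty {n} {p = p} ∣p∣≡1+k with nonempty? p
... | yes ne = ne
... | no ¬ne = contradiction (trans (sym ∣p∣≡1+k) (trans (cong ∣_∣ (Empty-unique ¬ne)) (∣⊥∣≡0 n))) λ ()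

∣p∣≡0⇒x∉p : ∀ {n} {p : Subset n} → ∣ p ∣ ≡ 0 → ∀ x → x ∉ p
∣p∣≡0⇒x∉p {p = p} ∣p∣≡0 x x∈p = contradiction (subst (1 ℕ.≤_) ∣p∣≡0 ⁅x⁆≤p) λ ()
  where
  ⁅x⁆≤p : 1 ℕ.≤ ∣ p ∣
  ⁅x⁆≤p = subst (ℕ._≤ ∣ p ∣) (∣⁅x⁆∣≡1 x)
    (p⊆q⇒∣p∣≤∣q∣ λ y∈⁅x⁆ → subst (_∈ p) (sym (x∈⁅y⁆⇒x≡y x y∈⁅x⁆)) x∈p)

subsingleton⇒∣p∣≤1 : ∀ {n} (p : Subset n) → (∀ {x y} → x ∈ p → y ∈ p → x ≡ y) → ∣ p ∣ ℕ.≤ 1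
subsingleton⇒∣p∣≤1 {n} p unique with nonempty? p
... | yes (x , x∈p) = subst (∣ p ∣ ℕ.≤_) (∣⁅x⁆∣≡1 x)
  (p⊆q⇒∣p∣≤∣q∣ λ y∈p → subst (_∈ ⁅ x ⁆) (unique x∈p y∈p) (x∈⁅x⁆ x))
... | no ¬ne = subst (ℕ._≤ 1) (sym (trans (cong ∣_∣ (Empty-unique ¬ne)) (∣⊥∣≡0 n))) ℕ.z≤n

weight'-remove : ∀ {n} (f : Fin n → ℕ) {p x} → x ∈ p → weight' f p ≡ f x ℕ.+ weight' f (p - x)
weight'-remove f {inside ∷ p} {zero} here = cong (f zero ℕ.+_) (cong (weight' (f ∘ suc)) (sym (p─⊥≡p p)))
weight'-remove f {inside ∷ p} {suc x} (there x∈p) =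
  trans (cong (f zero ℕ.+_) (weight'-remove (f ∘ suc) x∈p)) (x∙yz≈y∙xz (f zero) (f (suc x)) _)
weight'-remove f {outside ∷ p} {suc x} (there x∈p) = weight'-remove (f ∘ suc) x∈p

weight'-add : ∀ {n} (f : Fin n → ℕ) {p x} → x ∉ p → weight' f (p ∪ ⁅ x ⁆) ≡ f x ℕ.+ weight' f p
weight'-add f {p} {x} x∉p =
  trans (weight'-remove f (x∈p∪⁅x⁆ p x)) (cong (λ q → f x ℕ.+ weight' f q) (x∉p⇒p∪⁅x⁆-x≡p x∉p))

weight'-∣p∣≡0 : ∀ {n} (f : Fin n → ℕ) {p : Subset n} → ∣ p ∣ ≡ 0 → weight' f p ≡ 0
weight'-∣p∣≡0 f {[]} _ = refl
weight'-∣p∣≡0 f {outside ∷ p} ∣p∣≡0 = weight'-∣p∣≡0 (f ∘ suc) {p} ∣p∣≡0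

weight'-split : ∀ {n} (f : Fin n → ℕ) (p q : Subset n) → weight' f p ≡ weight' f (p ∩ q) ℕ.+ weight' f (p ─ q)
weight'-split f [] [] = refl
weight'-split f (inside ∷ p) (inside ∷ q) =
  trans (cong (f zero ℕ.+_) (weight'-split (f ∘ suc) p q)) (sym (ℕP.+-assoc (f zero) _ _))
weight'-split f (inside ∷ p) (outside ∷ q) =
  trans (cong (f zero ℕ.+_) (weight'-split (f ∘ suc) p q)) (x∙yz≈y∙xz (f zero) (weight' (f ∘ suc) (p ∩ q)) _)
weight'-split f (outside ∷ p) (inside ∷ q) = weight'-split (f ∘ suc) p q
weight'-split f (outside ∷ p) (outside ∷ q) = weight'-split (f ∘ suc) p q

⟦_⟧ : ∀ {n} {P : Fin n → Set} → Decidable P → Subset n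
⟦_⟧ {zero} P? = []
⟦_⟧ {suc n} P? = does (P? zero) ∷ ⟦ P? ∘ suc ⟧

∈⟦⟧⁺ : ∀ {n} {P : Fin n → Set} (P? : Decidable P) {x} → P x → x ∈ ⟦ P? ⟧
∈⟦⟧⁺ P? {zero} Px with P? zero
... | yes _ = here
... | no ¬Px = contradiction Px ¬Px
∈⟦⟧⁺ P? {suc x} Px = there (∈⟦⟧⁺ (P? ∘ suc) Px)

∈⟦⟧⁻ : ∀ {n} {P : Fin n → Set} (P? : Decidable P) {x} → x ∈ ⟦ P? ⟧ → P x
∈⟦⟧⁻ P? {zero} x∈P with P? zero | x∈P
... | yes Px | here = Px
∈⟦⟧⁻ P? {suc x} (there x∈P) = ∈⟦⟧⁻ (P? ∘ suc) x∈P

src tgt : ∀ {k} (g : Graph k) → Fin (m g) → Fin k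
src g i = proj₁ (edge g i)
tgt g i = proj₂ (edge g i)

IsEnd : ∀ {k} (g : Graph k) → Fin (m g) → Fin k → Set
IsEnd g i x = (x ≡ src g i) ⊎ (x ≡ tgt g i)

record Step {k} (g : Graph k) (P : Fin (m g) → Set) (x z : Fin k) : Set where
  constructor via
  field
    index   : Fin (m g)
    allowed : P index
    joins   : Joins g index x z

Walk : ∀ {k} (g : Graph k) → (Fin (m g) → Set) → Fin k → Fin k → Set
Walk g P = Star (Step g P)

_∖_ : ∀ {n} → (Fin n → Set) → Fin n → (Fin n → Set)
(P ∖ e) i = P i × i ≢ e

ReachesEnd : ∀ {k} (g : Graph k) → (Fin (m g) → Set) → Fin (m g) → Fin k → Set
ReachesEnd g P e x = Walk g (P ∖ e) x (src g e) ⊎ Walk g (P ∖ e) x (tgt g e)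

module _ {k} {g : Graph k} where

  joins-sym : ∀ {i x z} → Joins g i x z → Joins g i z x
  joins-sym (inj₁ e) = inj₂ e
  joins-sym (inj₂ e) = inj₁ e

  joins-nonloop : ∀ {i x z} → Joins g i x z → x ≢ z → src g i ≢ tgt g i
  joins-nonloop (inj₁ refl) x≢z = x≢z
  joins-nonloop (inj₂ refl) x≢z = x≢z ∘ sym

  joins-isEnd : ∀ {i x z} → Joins g i x z → IsEnd g i x
  joins-isEnd (inj₁ e) = inj₁ (cong proj₁ (sym e))
  joins-isEnd (inj₂ e) = inj₂ (cong proj₂ (sym e))

  walk-edge : ∀ {P i x z} → P i → Joins g i x z → Walk g P x z
  walk-edge {i = i} Pi j = via i Pi j ◅ ε

  walk-map : ∀ {P Q : Fin (m g) → Set} → (∀ {i} → P i → Q i) → ∀ {x y} → Walk g P x y → Walk g Q x y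
  walk-map f = Star.map λ (via i Pi j) → via i (f Pi) j

  walk-reverse : ∀ {P x y} → Walk g P x y → Walk g P y x
  walk-reverse = Star.reverse λ (via i Pi j) → via i Pi (joins-sym j)

  walk-constant : ∀ {P} → (∀ i → ¬ P i) → ∀ {x y} → Walk g P x y → x ≡ y
  walk-constant ¬P ε = refl
  walk-constant ¬P (via i Pi _ ◅ _) = contradiction Pi (¬P i)

  avoid-or-reach-end : ∀ {P} e {x y} → Walk g P x y → Walk g (P ∖ e) x y ⊎ ReachesEnd g P e x
  avoid-or-reach-end e ε = inj₁ ε
  avoid-or-reach-end e (via i Pi j ◅ w) with i Fin.≟ e
  ... | yes refl with joins-isEnd j
  ...   | inj₁ refl = inj₂ (inj₁ ε)
  ...   | inj₂ refl = inj₂ (inj₂ ε)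
  avoid-or-reach-end e (via i Pi j ◅ w) | no i≢e = Sum.map (s ◅_) (Sum.map (s ◅_) (s ◅_)) (avoid-or-reach-end e w)
    where s = via i (Pi , i≢e) j

  reaches-end : ∀ {P} e {x y} → Walk g P x y → IsEnd g e y → ReachesEnd g P e x
  reaches-end e w y-end with avoid-or-reach-end e w | y-end
  ... | inj₂ reach | _ = reach
  ... | inj₁ w′ | inj₁ refl = inj₁ w′
  ... | inj₁ w′ | inj₂ refl = inj₂ w′

  bypass : ∀ {P} e → Walk g (P ∖ e) (src g e) (tgt g e) → ∀ {x y} → Walk g P x y → Walk g (P ∖ e) x y
  bypass e detour ε = ε
  bypass e detour (via i Pi j ◅ w) with i Fin.≟ e
  ... | no i≢e = via i (Pi , i≢e) j ◅ bypass e detour w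
  ... | yes refl with j
  ...   | inj₁ refl = detour ◅◅ bypass e detour w
  ...   | inj₂ refl = walk-reverse detour ◅◅ bypass e detour w

  avoid-loop : ∀ {P} e → src g e ≡ tgt g e → ∀ {x y} → Walk g P x y → Walk g (P ∖ e) x y
  avoid-loop e loop = bypass e (subst (Walk g _ (src g e)) loop ε)

  Crossing : (Fin (m g) → Set) → (Fin k → Set) → (Fin k → Set) → Set
  Crossing P L R = Σ[ i ∈ Fin (m g) ] Σ[ a ∈ Fin k ] Σ[ b ∈ Fin k ] P i × Joins g i a b × L a × R b

  crossing : ∀ {P} {L R : Fin k → Set} → (∀ {i x z} → P i → Joins g i x z → L z ⊎ R z) →
             ∀ {x y} → L x → Walk g P x y → L y ⊎ Crossing P L R
  crossing side Lx ε = inj₁ Lx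
  crossing side Lx (via i Pi j ◅ w) with side Pi j
  ... | inj₁ Lz = crossing side Lz w
  ... | inj₂ Rz = inj₂ (i , _ , _ , Pi , j , Lx , Rz)


EndsIn : ∀ {k} (g : Graph k) → Subset (m g) → Subset k → Set
EndsIn g S V = ∀ i → i ∈ S → (src g i ∈ V) × (tgt g i ∈ V)

Connects : ∀ {k} (g : Graph k) → (Fin (m g) → Set) → Subset k → Set
Connects g P V = ∀ x y → x ∈ V → y ∈ V → Walk g P x y

∈∖⇒∈- : ∀ {n} {S : Subset n} {e i} → ((_∈ S) ∖ e) i → i ∈ S - e
∈∖⇒∈- (i∈S , i≢e) = x∈p∧x≢y⇒x∈p-y i∈S i≢e

walk-without : ∀ {k} {g : Graph k} {S e x y} → Walk g ((_∈ S) ∖ e) x y → Walk g (_∈ S - e) x y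
walk-without = walk-map ∈∖⇒∈-

endsIn-⊆ : ∀ {k} {g : Graph k} {S S′ V} → S′ ⊆ S → EndsIn g S V → EndsIn g S′ V
endsIn-⊆ S′⊆S ends i = ends i ∘ S′⊆S

Conn⇒Walk : ∀ {k} {g : Graph k} {S x y} → Conn g S x y → Walk g (_∈ S) x y
Conn⇒Walk here = ε
Conn⇒Walk (step i i∈S j c) = via i i∈S j ◅ Conn⇒Walk c

Walk⇒Conn : ∀ {k} {g : Graph k} {S x y} → Walk g (_∈ S) x y → Conn g S x y
Walk⇒Conn ε = here
Walk⇒Conn (via i i∈S j ◅ w) = step i i∈S j (Walk⇒Conn w)

-- Contraction
merge : ∀ {k} → Fin k → Fin k → Fin k → Fin k
merge p q x with x Fin.≟ q
... | yes _ = p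
... | no _ = x

merge-q : ∀ {k} (p q : Fin k) → merge p q q ≡ p
merge-q p q with q Fin.≟ q
... | yes _ = refl
... | no q≢q = contradiction refl q≢q

merge-fix : ∀ {k} (p q : Fin k) {x} → x ≢ q → merge p q x ≡ x
merge-fix p q {x} x≢q with x Fin.≟ q
... | yes x≡q = contradiction x≡q x≢q
... | no _ = refl

merge-p : ∀ {k} (p q : Fin k) → merge p q p ≡ p
merge-p p q with p Fin.≟ q
... | yes _ = refl
... | no _ = refl

merge-cases : ∀ {k} (p q x : Fin k) → (x ≡ q × merge p q x ≡ p) ⊎ (x ≢ q × merge p q x ≡ x)
merge-cases p q x with x Fin.≟ q
... | yes x≡q = inj₁ (x≡q , refl)
... | no x≢q = inj₂ (x≢q , refl)

merge∈p-q : ∀ {k} {V : Subset k} {p q x} → p ∈ V → p ≢ q → x ∈ V → merge p q x ∈ V - q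
merge∈p-q {p = p} {q} {x} p∈V p≢q x∈V with merge-cases p q x
... | inj₁ (_ , μx≡p) rewrite μx≡p = x∈p∧x≢y⇒x∈p-y p∈V p≢q
... | inj₂ (x≢q , μx≡x) rewrite μx≡x = x∈p∧x≢y⇒x∈p-y x∈V x≢q

identify : ∀ {k} → Graph k → Fin k → Fin k → Graph k
identify g p q = record
  { m = m g
  ; edge = λ i → merge p q (src g i) , merge p q (tgt g i)
  ; len = len g
  }

module _ {k} {g : Graph k} (p q : Fin k) where

  identify-joins : ∀ {i x z} → Joins g i x z → Joins (identify g p q) i (merge p q x) (merge p q z)
  identify-joins (inj₁ refl) = inj₁ refl
  identify-joins (inj₂ refl) = inj₂ refl

  walk-identify : ∀ {P x y} → Walk g P x y → Walk (identify g p q) P (merge p q x) (merge p q y)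
  walk-identify = Star.gmap (merge p q) λ (via i Pi j) → via i Pi (identify-joins j)

  identify-connects : ∀ {S V} j → Connects g (_∈ S) V →
                      Walk (identify g p q) ((_∈ S) ∖ j) (merge p q (src g j)) (merge p q (tgt g j)) →
                      Connects (identify g p q) (_∈ S - j) (V - q)
  identify-connects {V = V} j conn detour x y x∈V-q y∈V-q =
    subst₂ (Walk (identify g p q) _) (merge-fix p q (x∈p-y⇒x≢y x∈V-q)) (merge-fix p q (x∈p-y⇒x≢y y∈V-q))
      (walk-without (bypass j detour (walk-identify (conn x y (p─q⊆p V _ x∈V-q) (p─q⊆p V _ y∈V-q)))))

identify-endsIn : ∀ {k} {g : Graph k} {S V p q} → p ∈ V → p ≢ q → EndsIn g S V →
                  EndsIn (identify g p q) S (V - q)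
identify-endsIn p∈V p≢q ends i i∈S =
  merge∈p-q p∈V p≢q (proj₁ (ends i i∈S)) , merge∈p-q p∈V p≢q (proj₂ (ends i i∈S))

contract : ∀ {k} (g : Graph k) → Fin (m g) → Graph k
contract g e = identify g (src g e) (tgt g e)

module _ {k} {g : Graph k} (e : Fin (m g)) where

  private
    g/e = contract g e
    μ = merge (src g e) (tgt g e)

  merge-isEnd : ∀ {x} → IsEnd g e x → μ x ≡ src g e
  merge-isEnd (inj₁ refl) = merge-p (src g e) (tgt g e)
  merge-isEnd (inj₂ refl) = merge-q (src g e) (tgt g e)

  merge-joined : ∀ {a b} → Joins g e a b → μ a ≡ μ b
  merge-joined j = trans (merge-isEnd (joins-isEnd {g = g} j)) (sym (merge-isEnd (joins-isEnd {g = g} (joins-sym {g = g} j))))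

  contract-loop : src g/e e ≡ tgt g/e e
  contract-loop = merge-joined (inj₁ refl)

  walk-contract-avoid : ∀ {P x y} → Walk g P x y → Walk g/e (P ∖ e) (μ x) (μ y)
  walk-contract-avoid = avoid-loop e contract-loop ∘ walk-identify (src g e) (tgt g e)

  merged-walk : ∀ {x x′} → μ x ≡ μ x′ → Walk g (_≡ e) x x′
  merged-walk {x} {x′} μx≡μx′ with merge-cases (src g e) (tgt g e) x | merge-cases (src g e) (tgt g e) x′
  ... | inj₁ (refl , _) | inj₁ (refl , _) = ε
  ... | inj₂ (_ , μx≡x) | inj₂ (_ , μx′≡x′) =
        subst (Walk g (_≡ e) x) (trans (sym μx≡x) (trans μx≡μx′ μx′≡x′)) ε
  ... | inj₁ (refl , μx≡p) | inj₂ (_ , μx′≡x′) =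
        subst (Walk g (_≡ e) x) (trans (sym μx≡p) (trans μx≡μx′ μx′≡x′)) (walk-edge refl (inj₂ refl))
  ... | inj₂ (_ , μx≡x) | inj₁ (refl , μx′≡p) =
        subst (λ z → Walk g (_≡ e) z x′) (trans (sym μx′≡p) (trans (sym μx≡μx′) μx≡x))
          (walk-edge refl (inj₁ refl))

  walk-lift : ∀ {P a b} → Walk g/e P a b → ∀ {x y} → μ x ≡ a → μ y ≡ b → Walk g (λ i → P i ⊎ i ≡ e) x y
  walk-lift ε μx≡a μy≡a = walk-map inj₂ (merged-walk (trans μx≡a (sym μy≡a)))
  walk-lift (via i Pi j ◅ w) μx≡a μy≡b with j
  ... | inj₁ ij≡az = walk-map inj₂ (merged-walk (trans μx≡a (cong proj₁ (sym ij≡az))))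
                       ◅◅ via i (inj₁ Pi) (inj₁ refl) ◅ walk-lift w (cong proj₂ ij≡az) μy≡b
  ... | inj₂ ij≡za = walk-map inj₂ (merged-walk (trans μx≡a (cong proj₂ (sym ij≡za))))
                       ◅◅ via i (inj₁ Pi) (inj₂ refl) ◅ walk-lift w (cong proj₁ ij≡za) μy≡b

  contract-connects : ∀ {P V} → Connects g P V → Connects g/e (P ∖ e) (V - tgt g e)
  contract-connects {V = V} conn x y x∈V-q y∈V-q =
    subst₂ (Walk g/e _) (merge-fix (src g e) (tgt g e) (x∈p-y⇒x≢y x∈V-q)) (merge-fix (src g e) (tgt g e) (x∈p-y⇒x≢y y∈V-q))
      (walk-contract-avoid (conn x y (p─q⊆p V _ x∈V-q) (p─q⊆p V _ y∈V-q)))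


-- Counting vertices of connected graphs
connected⇒∣V∣≤1+∣S∣ : ∀ N {k} (g : Graph k) {S V} → ∣ S ∣ ≡ N →
                      EndsIn g S V → Connects g (_∈ S) V → ∣ V ∣ ℕ.≤ suc N
connected⇒∣V∣≤1+∣S∣ zero g {V = V} ∣S∣≡0 _ conn =
  subsingleton⇒∣p∣≤1 V λ {x} {y} x∈V y∈V → walk-constant (∣p∣≡0⇒x∉p ∣S∣≡0) (conn x y x∈V y∈V)
connected⇒∣V∣≤1+∣S∣ (suc N) g {S} {V} ∣S∣≡1+N ends conn = remove-edge (∣p∣≡1+k⇒Nonempty ∣S∣≡1+N)
  where
  remove-edge : Nonempty S → ∣ V ∣ ℕ.≤ suc (suc N)
  remove-edge (e , e∈S) with src g e Fin.≟ tgt g e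
  ... | yes loop = ℕP.m≤n⇒m≤1+n (connected⇒∣V∣≤1+∣S∣ N g (∣p∣≡1+k⇒∣p-x∣≡k e∈S ∣S∣≡1+N)
          (endsIn-⊆ {g = g} (p─q⊆p S _) ends)
          (λ x y x∈V y∈V → walk-without (avoid-loop e loop (conn x y x∈V y∈V))))
  ... | no p≢q = subst (ℕ._≤ suc (suc N)) (sym (x∈p⇒∣p∣≡1+∣p-x∣ (proj₂ (ends e e∈S))))
          (ℕ.s≤s (connected⇒∣V∣≤1+∣S∣ N (contract g e) (∣p∣≡1+k⇒∣p-x∣≡k e∈S ∣S∣≡1+N)
             (identify-endsIn {g = g} (proj₁ (ends e e∈S)) p≢q (endsIn-⊆ {g = g} (p─q⊆p S _) ends))
             (λ x y x∈ y∈ → walk-without (contract-connects e conn x y x∈ y∈))))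

subtree-loop-free : ∀ {k} {g : Graph k} {W S V} → IsSubtree g W S V → ∀ {e} → src g e ≡ tgt g e → e ∉ S
subtree-loop-free {g = g} {S = S} {V} (ends , _ , conn , size) {e} loop e∈S =
  contradiction (subst (ℕ._≤ suc ∣ S - e ∣) ∣V∣≡2+∣S-e∣ ∣V∣≤1+∣S-e∣) ℕP.1+n≰n
  where
  ∣V∣≡2+∣S-e∣ : ∣ V ∣ ≡ suc (suc ∣ S - e ∣)
  ∣V∣≡2+∣S-e∣ = trans (sym size) (cong suc (x∈p⇒∣p∣≡1+∣p-x∣ e∈S))
  ∣V∣≤1+∣S-e∣ : ∣ V ∣ ℕ.≤ suc ∣ S - e ∣
  ∣V∣≤1+∣S-e∣ = connected⇒∣V∣≤1+∣S∣ ∣ S - e ∣ g refl (endsIn-⊆ {g = g} (p─q⊆p S _) ends)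
    (λ x y x∈V y∈V → walk-without (avoid-loop e loop (Conn⇒Walk (conn x y x∈V y∈V))))

-- Minimum spanning trees
module MST {k} (H : Graph k) (U : Subset k) (endsH : ∀ f → (src H f ∈ U) × (tgt H f ∈ U)) where

  mst-connects : ∀ {T} → IsMST H U T → Connects H (_∈ T) U
  mst-connects mst x y x∈U y∈U = Conn⇒Walk (proj₁ (proj₂ (proj₂ (proj₁ mst))) x y x∈U y∈U)

  mst-size : ∀ {T} → IsMST H U T → suc ∣ T ∣ ≡ ∣ U ∣
  mst-size mst = proj₂ (proj₂ (proj₂ (proj₁ mst)))

  spanning-tree : ∀ {T} → Connects H (_∈ T) U → suc ∣ T ∣ ≡ ∣ U ∣ → IsSubtree H U T U
  spanning-tree conn size =
    (λ i _ → endsH i) , (λ _ x∈U → x∈U) , (λ x y x∈U y∈U → Walk⇒Conn (conn x y x∈U y∈U)) , size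

  joins⇒∈U : ∀ {i x z} → Joins H i x z → x ∈ U
  joins⇒∈U {i} j with joins-isEnd {g = H} j
  ... | inj₁ refl = proj₁ (endsH i)
  ... | inj₂ refl = proj₂ (endsH i)

  exchange : ∀ {T} → IsMST H U T → ∀ {g h} → g ∈ T → h ∉ T → ∀ {x y} → Joins H h x y →
             Walk H ((_∈ T) ∖ g) x (src H g) → Walk H ((_∈ T) ∖ g) y (tgt H g) →
             len H g ℕ.≤ len H h
  exchange {T} mst {g} {h} g∈T h∉T {x} {y} j x⇝p y⇝q =
    ℕP.+-cancelʳ-≤ (weight H (T - g)) (len H g) (len H h)
      (subst₂ ℕ._≤_ (weight'-remove (len H) g∈T) (weight'-add (len H) h∉T-g) (proj₂ mst T′ T′-spanning))
    where
    T′ = (T - g) ∪ ⁅ h ⁆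
    h∉T-g : h ∉ T - g
    h∉T-g = h∉T ∘ p─q⊆p T _
    into-T′ : ∀ {i} → ((_∈ T) ∖ g) i → i ∈ T′
    into-T′ = p⊆p∪q _ ∘ ∈∖⇒∈-
    p⇝q : Walk H (_∈ T′) (src H g) (tgt H g)
    p⇝q = walk-reverse (walk-map into-T′ x⇝p) ◅◅ via h (x∈p∪⁅x⁆ _ h) j ◅ walk-map into-T′ y⇝q
    ⇝p : ∀ z → z ∈ U → Walk H (_∈ T′) z (src H g)
    ⇝p z z∈U with reaches-end g (mst-connects mst z (src H g) z∈U (proj₁ (endsH g))) (inj₁ refl)
    ... | inj₁ z⇝p = walk-map into-T′ z⇝p
    ... | inj₂ z⇝q = walk-map into-T′ z⇝q ◅◅ walk-reverse p⇝q
    T′-spanning : IsSubtree H U T′ U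
    T′-spanning = spanning-tree (λ z w z∈U w∈U → ⇝p z z∈U ◅◅ walk-reverse (⇝p w w∈U))
      (trans (cong suc (trans (x∉p⇒∣p∪⁅x⁆∣≡1+∣p∣ h∉T-g) (sym (x∈p⇒∣p∣≡1+∣p-x∣ g∈T)))) (mst-size mst))

  Light : Subset (m H) → ℕ → Fin (m H) → Set
  Light T d i = (i ∈ T) × (len H i ℕ.≤ d)

  heavy-edge-avoidable : ∀ {T} → IsMST H U T → ∀ {h x y} → h ∉ T → Joins H h x y →
                         ∀ {Q g} → Q ⊆ T → g ∈ Q → len H h ℕ.< len H g →
                         Walk H (_∈ Q) x y → Walk H ((_∈ Q) ∖ g) x y
  heavy-edge-avoidable mst {h} h∉T j {Q} {g} Q⊆T g∈Q h<g w
    with avoid-or-reach-end g w | avoid-or-reach-end g (walk-reverse w)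
  ... | inj₁ x⇝y | _ = x⇝y
  ... | _ | inj₁ y⇝x = walk-reverse y⇝x
  ... | inj₂ (inj₁ x⇝p) | inj₂ (inj₁ y⇝p) = x⇝p ◅◅ walk-reverse y⇝p
  ... | inj₂ (inj₂ x⇝q) | inj₂ (inj₂ y⇝q) = x⇝q ◅◅ walk-reverse y⇝q
  ... | inj₂ (inj₁ x⇝p) | inj₂ (inj₂ y⇝q) =
        contradiction (exchange mst (Q⊆T g∈Q) h∉T j (in-T x⇝p) (in-T y⇝q)) (ℕP.<⇒≱ h<g)
    where in-T = walk-map λ (i∈Q , i≢g) → Q⊆T i∈Q , i≢g
  ... | inj₂ (inj₂ x⇝q) | inj₂ (inj₁ y⇝p) =
        contradiction (exchange mst (Q⊆T g∈Q) h∉T (joins-sym {g = H} j) (in-T y⇝p) (in-T x⇝q)) (ℕP.<⇒≱ h<g)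
    where in-T = walk-map λ (i∈Q , i≢g) → Q⊆T i∈Q , i≢g

  cycle-property : ∀ {T} → IsMST H U T → ∀ h {x y} → Joins H h x y → Walk H (Light T (len H h)) x y
  cycle-property {T} mst h {x} {y} j with h ∈? T
  ... | yes h∈T = walk-edge (h∈T , ℕP.≤-refl) j
  ... | no h∉T = drop-heavy ∣ T ∣ refl (λ i∈T → i∈T)
                   (mst-connects mst x y (joins⇒∈U j) (joins⇒∈U (joins-sym {g = H} j)))
    where
    drop-heavy : ∀ N {Q} → ∣ Q ∣ ≡ N → Q ⊆ T → Walk H (_∈ Q) x y → Walk H (Light T (len H h)) x y
    drop-heavy N {Q} ∣Q∣≡N Q⊆T w with FinP.any? (λ i → (i ∈? Q) ×-dec (len H h ℕP.<? len H i))
    ... | no no-heavy = walk-map (λ {i} i∈Q → Q⊆T i∈Q , ℕP.≮⇒≥ λ h<i → no-heavy (i , i∈Q , h<i)) w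
    drop-heavy zero ∣Q∣≡0 _ _ | yes (g , g∈Q , _) = contradiction g∈Q (∣p∣≡0⇒x∉p ∣Q∣≡0 g)
    drop-heavy (suc N) ∣Q∣≡1+N Q⊆T w | yes (g , g∈Q , h<g) =
      drop-heavy N (∣p∣≡1+k⇒∣p-x∣≡k g∈Q ∣Q∣≡1+N) (Q⊆T ∘ p─q⊆p _ _)
        (walk-without (heavy-edge-avoidable mst h∉T j Q⊆T g∈Q h<g w))

  contract-ends : ∀ g → src H g ≢ tgt H g → ∀ f →
                  (src (contract H g) f ∈ U - tgt H g) × (tgt (contract H g) f ∈ U - tgt H g)
  contract-ends g p≢q f = merge∈p-q (proj₁ (endsH g)) p≢q (proj₁ (endsH f)) ,
                          merge∈p-q (proj₁ (endsH g)) p≢q (proj₂ (endsH f))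

  mst-contract : ∀ {T} → IsMST H U T → ∀ {g} → g ∈ T → src H g ≢ tgt H g →
                 IsMST (contract H g) (U - tgt H g) (T - g)
  mst-contract {T} mst {g} g∈T p≢q = T-g-spanning , T-g-minimal
    where
    H/g = contract H g
    U′ = U - tgt H g
    q∈U = proj₂ (endsH g)

    T-g-spanning : IsSubtree H/g U′ (T - g) U′
    T-g-spanning = (λ i _ → contract-ends g p≢q i) , (λ _ x∈U′ → x∈U′) ,
      (λ x y x∈U′ y∈U′ → Walk⇒Conn (walk-without (contract-connects g (mst-connects mst) x y x∈U′ y∈U′))) ,
      ℕP.suc-injective (trans (cong suc (sym (x∈p⇒∣p∣≡1+∣p-x∣ g∈T)))
                              (trans (mst-size mst) (x∈p⇒∣p∣≡1+∣p-x∣ q∈U)))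

    T-g-minimal : ∀ T″ → IsSubtree H/g U′ T″ U′ → weight H/g (T - g) ℕ.≤ weight H/g T″
    T-g-minimal T″ T″-spanning = ℕP.+-cancelˡ-≤ (len H g) _ _
      (subst₂ ℕ._≤_ (weight'-remove (len H) g∈T) (weight'-add (len H) g∉T″) (proj₂ mst (T″ ∪ ⁅ g ⁆) lifted))
      where
      g∉T″ : g ∉ T″
      g∉T″ = subtree-loop-free T″-spanning (contract-loop {g = H} g)
      into : ∀ {i} → (i ∈ T″) ⊎ (i ≡ g) → i ∈ T″ ∪ ⁅ g ⁆
      into (inj₁ i∈T″) = p⊆p∪q _ i∈T″
      into (inj₂ refl) = x∈p∪⁅x⁆ T″ g
      lift : Connects H (_∈ T″ ∪ ⁅ g ⁆) U
      lift x y x∈U y∈U = walk-map into (walk-lift g (Conn⇒Walk (proj₁ (proj₂ (proj₂ T″-spanning)) _ _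
        (merge∈p-q (proj₁ (endsH g)) p≢q x∈U) (merge∈p-q (proj₁ (endsH g)) p≢q y∈U))) refl refl)
      lifted : IsSubtree H U (T″ ∪ ⁅ g ⁆) U
      lifted = spanning-tree lift (trans (cong suc (x∉p⇒∣p∪⁅x⁆∣≡1+∣p∣ g∉T″))
        (trans (cong suc (proj₂ (proj₂ (proj₂ T″-spanning)))) (sym (x∈p⇒∣p∣≡1+∣p-x∣ q∈U))))

-- Bounding an MST by a covering request graph
module Bottleneck (c : ℚ) {{c≥0 : NonNegative c}} where

  Covers : ∀ {k} (H : Graph k) → Subset (m H) → (R : Graph k) → Subset (m R) → Set
  Covers H T R A = ∀ j → j ∈ A → Walk H (λ i → (i ∈ T) × (len H i ≤[ c ] len R j)) (src R j) (tgt R j)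

  covers-contract : ∀ {k} {H R : Graph k} {T A} g → Covers H T R A →
                    Covers (contract H g) (T - g) (identify R (src H g) (tgt H g)) A
  covers-contract g covers i i∈A =
    walk-map (λ ((i∈T , i≤) , i≢g) → x∈p∧x≢y⇒x∈p-y i∈T i≢g , i≤) (walk-contract-avoid g (covers i i∈A))

  mst-bottleneck-bound : ∀ N {k} (H : Graph k) (U : Subset k) (endsH : ∀ f → (src H f ∈ U) × (tgt H f ∈ U)) →
    ∀ {T} → IsMST H U T → ∀ R {A} → ∣ A ∣ ≡ N → EndsIn R A U → Covers H T R A → Connects R (_∈ A) U →
    weight H T ≤[ c ] weight R A
  mst-bottleneck-bound zero H U endsH {T} mst R {A} ∣A∣≡0 endsR _ connR =
    subst (_≤[ c ] weight R A) (sym (weight'-∣p∣≡0 (len H) {T} ∣T∣≡0)) (0≤[] c (weight R A))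
    where
    open MST H U endsH
    ∣T∣≡0 : ∣ T ∣ ≡ 0
    ∣T∣≡0 = ℕP.n≤0⇒n≡0 (ℕP.≤-pred
      (subst (ℕ._≤ 1) (sym (mst-size mst)) (connected⇒∣V∣≤1+∣S∣ 0 R ∣A∣≡0 endsR connR)))
  mst-bottleneck-bound (suc N) H U endsH {T} mst R {A} ∣A∣≡1+N endsR covers connR =
    cover-request (∣p∣≡1+k⇒Nonempty ∣A∣≡1+N)
    where
    open MST H U endsH

    redundant : ∀ {j} → j ∈ A → Walk R ((_∈ A) ∖ j) (src R j) (tgt R j) → weight H T ≤[ c ] weight R A
    redundant {j} j∈A u⇝v = ≤[]-monoʳ c {weight H T} {weight R (A - j)}
      (mst-bottleneck-bound N H U endsH mst R (∣p∣≡1+k⇒∣p-x∣≡k j∈A ∣A∣≡1+N)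
        (endsIn-⊆ {g = R} (p─q⊆p A _) endsR) (λ i → covers i ∘ p─q⊆p A _)
        (λ x y x∈U y∈U → walk-without (bypass j u⇝v (connR x y x∈U y∈U))))
      (subst (weight R (A - j) ℕ.≤_) (sym (weight'-remove (len R) j∈A)) (ℕP.m≤n+m _ _))

    contracted : ∀ {j} → j ∈ A → ∀ {g a b} → g ∈ T → len H g ≤[ c ] len R j → Joins H g a b → a ≢ b →
                 Walk R ((_∈ A) ∖ j) (src R j) a → Walk R ((_∈ A) ∖ j) b (tgt R j) → weight H T ≤[ c ] weight R A
    contracted {j} j∈A {g} {a} {b} g∈T g≤cj jg a≢b u⇝a b⇝v =
      subst₂ _≤[ c ]_ (sym (weight'-remove (len H) g∈T)) (sym (weight'-remove (len R) j∈A))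
        (≤[]-+ c {len H g} {weight H (T - g)} {len R j} {weight R (A - j)} g≤cj
          (mst-bottleneck-bound N (contract H g) (U - q) (contract-ends g p≢q) (mst-contract mst g∈T p≢q)
             (identify R p q) (∣p∣≡1+k⇒∣p-x∣≡k j∈A ∣A∣≡1+N)
             (identify-endsIn {g = R} (proj₁ (endsH g)) p≢q (endsIn-⊆ {g = R} (p─q⊆p A _) endsR))
             (covers-contract {H = H} {R} {T} {A - j} g (λ i → covers i ∘ p─q⊆p A _))
             (identify-connects p q j connR u⇝v)))
      where
      p = src H g
      q = tgt H g
      p≢q = joins-nonloop {g = H} jg a≢b
      u⇝v : Walk (identify R p q) ((_∈ A) ∖ j) (merge p q (src R j)) (merge p q (tgt R j))
      u⇝v = walk-identify p q u⇝a
            ◅◅ subst (λ z → Walk (identify R p q) ((_∈ A) ∖ j) z (merge p q (tgt R j)))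
                     (sym (merge-joined {g = H} g jg)) (walk-identify p q b⇝v)

    -- Walking along the MST walk that covers j, some MST edge leaves the side of src j in R minus j.
    side : ∀ {j} → j ∈ A → ∀ {i x z} → (i ∈ T) × (len H i ≤[ c ] len R j) → Joins H i x z →
           Walk R ((_∈ A) ∖ j) (src R j) z ⊎ Walk R ((_∈ A) ∖ j) z (tgt R j)
    side {j} j∈A _ jz
      with reaches-end j (connR _ (src R j) (joins⇒∈U (joins-sym {g = H} jz)) (proj₁ (endsR j j∈A))) (inj₁ refl)
    ... | inj₁ z⇝u = inj₁ (walk-reverse z⇝u)
    ... | inj₂ z⇝v = inj₂ z⇝v

    cover-request : Nonempty A → weight H T ≤[ c ] weight R A
    cover-request (j , j∈A) with crossing (side j∈A) ε (covers j j∈A)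
    ... | inj₁ u⇝v = redundant j∈A u⇝v
    ... | inj₂ (g , a , b , (g∈T , g≤cj) , jg , u⇝a , b⇝v) with a Fin.≟ b
    ...   | yes refl = redundant j∈A (u⇝a ◅◅ b⇝v)
    ...   | no a≢b = contracted j∈A g∈T g≤cj jg a≢b u⇝a b⇝v

-- Double-tree tours
module _ {k} {g : Graph k} where

  walk-length : ∀ {P x y} → Walk g P x y → ℕ
  walk-length ε = 0
  walk-length (via i _ _ ◅ w) = len g i ℕ.+ walk-length w

  walk-length-◅◅ : ∀ {P x y z} (w₁ : Walk g P x y) (w₂ : Walk g P y z) →
                   walk-length (w₁ ◅◅ w₂) ≡ walk-length w₁ ℕ.+ walk-length w₂
  walk-length-◅◅ ε w₂ = refl
  walk-length-◅◅ (via i _ _ ◅ w₁) w₂ =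
    trans (cong (len g i ℕ.+_) (walk-length-◅◅ w₁ w₂)) (sym (ℕP.+-assoc (len g i) _ _))

  walk-length-map : ∀ {P Q : Fin (m g) → Set} (f : ∀ {i} → P i → Q i) {x y} (w : Walk g P x y) →
                    walk-length (walk-map f w) ≡ walk-length w
  walk-length-map f ε = refl
  walk-length-map f (via i _ _ ◅ w) = cong (len g i ℕ.+_) (walk-length-map f w)

  walk-length-◅◅-step : ∀ {P x y z} (w : Walk g P x y) (s : Step g P y z) d →
                        walk-length (w ◅◅ s ◅ ε) ℕ.+ d ≡ walk-length w ℕ.+ (len g (Step.index s) ℕ.+ d)
  walk-length-◅◅-step w s d = trans (cong (ℕ._+ d) (walk-length-◅◅ w (s ◅ ε)))
    (trans (ℕP.+-assoc (walk-length w) _ d) (cong (λ l → walk-length w ℕ.+ (l ℕ.+ d)) (ℕP.+-identityʳ _)))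

  data Visits {P} : ∀ {x y} → Walk g P x y → Fin k → Set where
    start : ∀ {x y} {w : Walk g P x y} → Visits w x
    later : ∀ {x z y} {s : Step g P x z} {w : Walk g P z y} {v} → Visits w v → Visits (s ◅ w) v

  visits? : ∀ {P x y} (w : Walk g P x y) v → Dec (Visits w v)
  visits? {x = x} w v with v Fin.≟ x
  visits? w v | yes refl = yes start
  visits? ε v | no v≢x = no λ { start → v≢x refl }
  visits? (s ◅ w) v | no v≢x with visits? w v
  ... | yes visited = yes (later visited)
  ... | no ¬visited = no λ { start → v≢x refl ; (later visited) → ¬visited visited }

  visited⇒reachable : ∀ {P x y v} (w : Walk g P x y) → Visits w v → Walk g P x v
  visited⇒reachable w start = ε
  visited⇒reachable (s ◅ w) (later visited) = s ◅ visited⇒reachable w visited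

  visits-◅◅ˡ : ∀ {P x y z v} (w₁ : Walk g P x y) (w₂ : Walk g P y z) → Visits w₁ v → Visits (w₁ ◅◅ w₂) v
  visits-◅◅ˡ ε w₂ start = start
  visits-◅◅ˡ (s ◅ w₁) w₂ start = start
  visits-◅◅ˡ (s ◅ w₁) w₂ (later visited) = later (visits-◅◅ˡ w₁ w₂ visited)

  visits-◅◅ʳ : ∀ {P x y z v} (w₁ : Walk g P x y) (w₂ : Walk g P y z) → Visits w₂ v → Visits (w₁ ◅◅ w₂) v
  visits-◅◅ʳ ε w₂ visited = visited
  visits-◅◅ʳ (s ◅ w₁) w₂ visited = later (visits-◅◅ʳ w₁ w₂ visited)

  visits-map : ∀ {P Q : Fin (m g) → Set} (f : ∀ {i} → P i → Q i) {x y v} (w : Walk g P x y) →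
               Visits w v → Visits (walk-map f w) v
  visits-map f w start = start
  visits-map f (s ◅ w) (later visited) = later (visits-map f w visited)

  src-reachable : ∀ {P s i y y′} → P i → Joins g i y y′ → Walk g P s y → Walk g P s (src g i)
  src-reachable Pi (inj₁ refl) s⇝y = s⇝y
  src-reachable Pi (inj₂ refl) s⇝y = s⇝y ◅◅ walk-edge Pi (inj₂ refl)

  walk-restrict : ∀ {P Q : Fin (m g) → Set} {s} → (∀ {i y y′} → P i → Joins g i y y′ → Walk g P s y → Q i) →
                  ∀ {y} → Walk g P s y → Walk g Q s y
  walk-restrict {P} {Q} {s} allowed = go ε
    where
    go : ∀ {y z} → Walk g P s y → Walk g P y z → Walk g Q y z
    go s⇝y ε = ε
    go s⇝y (via i Pi j ◅ w) = via i (allowed Pi j s⇝y) j ◅ go (s⇝y ◅◅ walk-edge Pi j) w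

Tour : ∀ {k} (g : Graph k) → Subset (m g) → Fin k → Set
Tour g Q r = Σ[ w ∈ Walk g (_∈ Q) r r ]
  (walk-length w ℕ.≤ weight g Q ℕ.+ weight g Q) × (∀ x → Walk g (_∈ Q) r x → Visits w x)

module _ {k} {g : Graph k} where

  tour-isolated : ∀ {Q r} → (∀ e → e ∈ Q → ¬ IsEnd g e r) → Tour g Q r
  tour-isolated {Q} {r} isolated = ε , ℕ.z≤n , covered
    where
    covered : ∀ x → Walk g (_∈ Q) r x → Visits ε x
    covered x ε = start
    covered x (via i i∈Q j ◅ _) = contradiction (joins-isEnd {g = g} j) (isolated i i∈Q)

  split-at-edge : ∀ {Q e r b} → e ∈ Q → Joins g e r b →
                  ∀ {x} → Walk g (_∈ Q) r x → Walk g (_∈ Q - e) r x ⊎ Walk g (_∈ Q - e) b x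
  split-at-edge {Q} {e} e∈Q j w = orient j (reaches-end e (walk-reverse w) (joins-isEnd {g = g} j))
    where
    back : ∀ {x y} → Walk g ((_∈ Q) ∖ e) x y → Walk g (_∈ Q - e) y x
    back = walk-reverse ∘ walk-without
    orient : ∀ {r b x} → Joins g e r b → ReachesEnd g (_∈ Q) e x → Walk g (_∈ Q - e) r x ⊎ Walk g (_∈ Q - e) b x
    orient (inj₁ refl) = Sum.map back back
    orient (inj₂ refl) = Sum.swap ∘ Sum.map back back

  tour-reuse : ∀ {Q e r b} → e ∈ Q → Joins g e r b → (T : Tour g (Q - e) r) → Visits (proj₁ T) b → Tour g Q r
  tour-reuse {Q} {e} {r} {b} e∈Q j (w , length≤ , covered) visits-b =
    walk-map into-Q w ,
    subst (ℕ._≤ _) (sym (walk-length-map into-Q w)) (ℕP.≤-trans length≤ (ℕP.+-mono-≤ weight-mono weight-mono)) ,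
    λ x r⇝x → visits-map into-Q w (covered x (from-r (split-at-edge e∈Q j r⇝x)))
    where
    from-r : ∀ {x} → Walk g (_∈ Q - e) r x ⊎ Walk g (_∈ Q - e) b x → Walk g (_∈ Q - e) r x
    from-r = Sum.[ (λ r⇝x → r⇝x) , (λ b⇝x → visited⇒reachable w visits-b ◅◅ b⇝x) ]′
    into-Q : ∀ {i} → i ∈ Q - e → i ∈ Q
    into-Q = p─q⊆p Q _
    weight-mono : weight g (Q - e) ℕ.≤ weight g Q
    weight-mono = subst (weight g (Q - e) ℕ.≤_) (sym (weight'-remove (len g) e∈Q)) (ℕP.m≤n+m _ _)

  tour-glue : ∀ {Q e r b} → e ∈ Q → Joins g e r b → ∀ X →
              (∀ {y} → Walk g (_∈ Q - e) b y → Walk g (_∈ (Q - e) ∩ X) b y) →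
              (∀ {y} → Walk g (_∈ Q - e) r y → Walk g (_∈ (Q - e) ─ X) r y) →
              Tour g ((Q - e) ∩ X) b → Tour g ((Q - e) ─ X) r → Tour g Q r
  tour-glue {Q} {e} e∈Q j X inside-X outside-X (w₂ , length₂≤ , covered₂) (w₃ , length₃≤ , covered₃) =
    W , length≤ , covered
    where
    into-Q : ∀ {Y} {i} → i ∈ (Q - e) ∩ Y ⊎ i ∈ (Q - e) ─ Y → i ∈ Q
    into-Q (inj₁ i∈) = p─q⊆p Q _ (proj₁ (x∈p∩q⁻ _ _ i∈))
    into-Q (inj₂ i∈) = p─q⊆p Q _ (p─q⊆p _ _ i∈)
    w₂′ = walk-map (into-Q ∘ inj₁) w₂
    w₃′ = walk-map (into-Q {X} ∘ inj₂) w₃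
    W : Walk g (_∈ Q) _ _
    W = via e e∈Q j ◅ w₂′ ◅◅ via e e∈Q (joins-sym {g = g} j) ◅ w₃′
    E = len g e
    B = weight g ((Q - e) ∩ X)
    R = weight g ((Q - e) ─ X)
    length≡ : walk-length W ≡ E ℕ.+ (walk-length w₂ ℕ.+ (E ℕ.+ walk-length w₃))
    length≡ = cong (E ℕ.+_) (trans (walk-length-◅◅ w₂′ _)
      (cong₂ ℕ._+_ (walk-length-map _ w₂) (cong (E ℕ.+_) (walk-length-map _ w₃))))
    weight≡ : weight g Q ℕ.+ weight g Q ≡ E ℕ.+ ((B ℕ.+ B) ℕ.+ (E ℕ.+ (R ℕ.+ R)))
    weight≡ = trans (cong₂ ℕ._+_ weight-Q weight-Q) (solve 3 (λ E B R →
        (E :+ (B :+ R)) :+ (E :+ (B :+ R)) := E :+ ((B :+ B) :+ (E :+ (R :+ R)))) refl E B R)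
      where
      open +-*-Solver
      weight-Q : weight g Q ≡ E ℕ.+ (B ℕ.+ R)
      weight-Q = trans (weight'-remove (len g) e∈Q) (cong (E ℕ.+_) (weight'-split (len g) (Q - e) X))
    length≤ : walk-length W ℕ.≤ weight g Q ℕ.+ weight g Q
    length≤ = subst₂ ℕ._≤_ (sym length≡) (sym weight≡)
      (ℕP.+-monoʳ-≤ E (ℕP.+-mono-≤ length₂≤ (ℕP.+-monoʳ-≤ E length₃≤)))
    covered : ∀ x → Walk g (_∈ Q) _ x → Visits W x
    covered x r⇝x with split-at-edge e∈Q j r⇝x
    ... | inj₁ r⇝x′ = later (visits-◅◅ʳ w₂′ _ (later (visits-map _ w₃ (covered₃ x (outside-X r⇝x′)))))
    ... | inj₂ b⇝x = later (visits-◅◅ˡ w₂′ _ (visits-map _ w₂ (covered₂ x (inside-X b⇝x))))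

tour : ∀ N {k} (g : Graph k) (Q : Subset (m g)) → ∣ Q ∣ ℕ.< N → ∀ r → Tour g Q r
tour (suc N) g Q (ℕ.s≤s ∣Q∣≤N) r
  with FinP.any? (λ e → (e ∈? Q) ×-dec ((r Fin.≟ src g e) ⊎-dec (r Fin.≟ tgt g e)))
... | no isolated = tour-isolated λ e e∈Q r-end → isolated (e , e∈Q , r-end)
... | yes (e , e∈Q , r-end) = through (other-end r-end)
  where
  Q′ = Q - e
  ∣Q′∣<N : ∣ Q′ ∣ ℕ.< N
  ∣Q′∣<N = subst (ℕ._≤ N) (x∈p⇒∣p∣≡1+∣p-x∣ e∈Q) ∣Q∣≤N

  other-end : IsEnd g e r → Σ[ b ∈ Fin _ ] Joins g e r b
  other-end (inj₁ refl) = tgt g e , inj₁ refl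
  other-end (inj₂ refl) = src g e , inj₂ refl

  through : Σ[ b ∈ Fin _ ] Joins g e r b → Tour g Q r
  through (b , j) with tour N g Q′ ∣Q′∣<N r
  ... | T₁@(w₁ , _ , covered₁) with visits? w₁ b
  ...   | yes visits-b = tour-reuse e∈Q j T₁ visits-b
  ...   | no ¬visits-b = tour-glue e∈Q j X inside-X outside-X
                           (tour N g (Q′ ∩ X) (ℕP.≤-<-trans (∣p∩q∣≤∣p∣ Q′ X) ∣Q′∣<N) b)
                           (tour N g (Q′ ─ X) (ℕP.≤-<-trans (∣p─q∣≤∣p∣ Q′ X) ∣Q′∣<N) r)
    where
    Tᵇ = tour N g Q′ ∣Q′∣<N b
    wᵇ = proj₁ Tᵇ
    -- the tour from b decides which edges of Q′ lie in the component of b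
    X : Subset (m g)
    X = ⟦ (λ i → visits? wᵇ (src g i)) ⟧
    inside-X : ∀ {y} → Walk g (_∈ Q′) b y → Walk g (_∈ Q′ ∩ X) b y
    inside-X = walk-restrict λ i∈Q′ ji b⇝y →
      x∈p∩q⁺ (i∈Q′ , ∈⟦⟧⁺ (λ i → visits? wᵇ (src g i)) (proj₂ (proj₂ Tᵇ) _ (src-reachable i∈Q′ ji b⇝y)))
    outside-X : ∀ {y} → Walk g (_∈ Q′) r y → Walk g (_∈ Q′ ─ X) r y
    outside-X = walk-restrict λ i∈Q′ ji r⇝y → x∈p∧x∉q⇒x∈p─q i∈Q′ λ i∈X →
      ¬visits-b (covered₁ b (src-reachable i∈Q′ ji r⇝y ◅◅
        walk-reverse (visited⇒reachable wᵇ (∈⟦⟧⁻ (λ i → visits? wᵇ (src g i)) i∈X))))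

module _ {n} {G : Graph n} where

  walkLen-++ : ∀ {x y z a b} → WalkLen G x y a → WalkLen G y z b → WalkLen G x z (a ℕ.+ b)
  walkLen-++ nil w₂ = w₂
  walkLen-++ (cons {d = d} i j w₁) w₂ = subst (WalkLen G _ _) (sym (ℕP.+-assoc (len G i) d _)) (cons i j (walkLen-++ w₁ w₂))

  walkLen-reverse : ∀ {x y a} → WalkLen G x y a → WalkLen G y x a
  walkLen-reverse nil = nil
  walkLen-reverse (cons {d = d} i j w) =
    subst (WalkLen G _ _) (trans (ℕP.+-comm d _) (cong (ℕ._+ d) (ℕP.+-identityʳ (len G i))))
    (walkLen-++ (walkLen-reverse w) (cons i (joins-sym {g = G} j) nil))

  toWalkLen : ∀ {P x y} (w : Walk G P x y) → WalkLen G x y (walk-length w)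
  toWalkLen ε = nil
  toWalkLen (via i _ j ◅ w) = cons i j (toWalkLen w)

  walkLen-0⇒≡ : (∀ i → 1 ℕ.≤ len G i) → ∀ {x y a} → WalkLen G x y a → a ≡ 0 → x ≡ y
  walkLen-0⇒≡ positive nil _ = refl
  walkLen-0⇒≡ positive (cons i _ _) a≡0 =
    contradiction (subst (1 ℕ.≤_) (ℕP.m+n≡0⇒m≡0 (len G i) a≡0) (positive i)) λ ()

-- Cutting a walk at the terminals
module Segmentation {n} (G : Graph n) (P : Fin (m G) → Set) (U : Subset n) where

  record TerminalWalk : Set where
    field
      {from to} : Fin n
      from∈U : from ∈ U
      to∈U   : to ∈ U
      walk   : Walk G P from to

  open TerminalWalk

  requests : List TerminalWalk → Graph n
  requests L = record
    { m = List.length L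
    ; edge = λ j → from (List.lookup L j) , to (List.lookup L j)
    ; len = λ j → walk-length (walk (List.lookup L j))
    }

  total-length : List TerminalWalk → ℕ
  total-length = sum ∘ List.map (walk-length ∘ walk)

  weight-requests : ∀ L → weight (requests L) ⊤ ≡ total-length L
  weight-requests [] = refl
  weight-requests (s ∷ L) = cong (walk-length (walk s) ℕ.+_) (weight-requests L)

  requests-∷ : ∀ s L {x y} → Walk (requests L) (_∈ ⊤) x y → Walk (requests (s ∷ L)) (_∈ ⊤) x y
  requests-∷ s L = Star.map λ (via i _ j) → via (suc i) ∈⊤ j

  request-edge : ∀ s L → Walk (requests (s ∷ L)) (_∈ ⊤) (from s) (to s)
  request-edge s L = via zero ∈⊤ (inj₁ refl) ◅ ε

  Segments : ∀ {x r} → Walk G P x r → Fin n → ℕ → Set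
  Segments w u ℓ = Σ[ L ∈ List TerminalWalk ] (total-length L ≡ ℓ ℕ.+ walk-length w) ×
                   (∀ v → v ∈ U → Visits w v → Walk (requests L) (_∈ ⊤) u v)

  segment : ∀ {x r} → r ∈ U → (w : Walk G P x r) → ∀ {u} → u ∈ U → (prefix : Walk G P u x) →
            (x ∈ U → u ≡ x) → Segments w u (walk-length prefix)
  segment r∈U ε u∈U prefix _ = last ∷ [] , refl , λ { _ _ start → request-edge last [] }
    where
    last : TerminalWalk
    last = record { from∈U = u∈U ; to∈U = r∈U ; walk = prefix }
  segment r∈U (s@(via i Pi j) ◅ w) {u} u∈U prefix anchored with _ ∈? U
  ... | yes z∈U = piece ∷ L , length≡ , covered
    where
    piece : TerminalWalk
    piece = record { from∈U = u∈U ; to∈U = z∈U ; walk = prefix ◅◅ s ◅ ε }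
    rest = segment r∈U w z∈U ε λ _ → refl
    L = proj₁ rest
    length≡ : walk-length (prefix ◅◅ s ◅ ε) ℕ.+ total-length L ≡ walk-length prefix ℕ.+ (len G i ℕ.+ walk-length w)
    length≡ = trans (cong (walk-length (prefix ◅◅ s ◅ ε) ℕ.+_) (proj₁ (proj₂ rest)))
                    (walk-length-◅◅-step prefix s _)
    covered : ∀ v → v ∈ U → Visits (s ◅ w) v → Walk (requests (piece ∷ L)) (_∈ ⊤) u v
    covered v v∈U start = subst (Walk _ _ u) (anchored v∈U) ε
    covered v v∈U (later visited) = request-edge piece L ◅◅ requests-∷ piece L (proj₂ (proj₂ rest) v v∈U visited)
  ... | no z∉U = proj₁ rest , trans (proj₁ (proj₂ rest)) (walk-length-◅◅-step prefix s _) , covered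
    where
    rest = segment r∈U w u∈U (prefix ◅◅ s ◅ ε) λ z∈U → contradiction z∈U z∉U
    covered : ∀ v → v ∈ U → Visits (s ◅ w) v → Walk (requests (proj₁ rest)) (_∈ ⊤) u v
    covered v v∈U start = subst (Walk _ _ u) (anchored v∈U) ε
    covered v v∈U (later visited) = proj₂ (proj₂ rest) v v∈U visited

-- Closest-terminal maps
module TerminalMap
  (e : ℚ) (1≤e : 1ℚ ≤ e) {n} (G H : Graph n) (U : Subset n)
  (endsH : ∀ f → (src H f ∈ U) × (tgt H f ∈ U))
  (positive : ∀ i → 1 ℕ.≤ len G i)
  (t : Fin n → Fin n)
  (closest : ∀ x u → u ∈ U → ∀ b → WalkLen G x u b → ∃[ a ] (WalkLen G x (t x) a × (a ≤[ e ] b)))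
  (edge-image : ∀ i x y → edge G i ≡ (x , y) → ∃[ f ] (Joins H f (t x) (t y) ×
     (∀ d₁ d₂ → WalkLen G (t x) x d₁ → WalkLen G y (t y) d₂ → len H f ≤[ e ] d₁ ℕ.+ len G i ℕ.+ d₂)))
  where

  private instance
    e≥0 : NonNegative e
    e≥0 = nonNegative (ℚP.≤-trans (ℚP.nonNegative⁻¹ 1ℚ) 1≤e)
    e²≥0 : NonNegative (e * e)
    e²≥0 = ℚP.nonNeg*nonNeg⇒nonNeg e e

  open MST H U endsH
  open Bottleneck (e * e)

  t-fixes-terminals : ∀ {u} → u ∈ U → t u ≡ u
  t-fixes-terminals {u} u∈U with closest u u u∈U 0 nil
  ... | a , u⇝tu , a≤e·0 =
    sym (walkLen-0⇒≡ positive u⇝tu (ℕP.n≤0⇒n≡0 (ℕ→ℚ-cancel-≤ (subst (ℕ→ℚ a ≤_) (ℚP.*-zeroʳ e) a≤e·0))))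

  image-edge : ∀ {i x z} → Joins G i x z → ∀ {u v p s} → u ∈ U → v ∈ U → WalkLen G u x p → WalkLen G z v s →
               Σ[ f ∈ Fin (m H) ] Joins H f (t x) (t z) × (len H f ≤[ e * e ] p ℕ.+ (len G i ℕ.+ s))
  image-edge {i} {x} {z} j {u} {v} {p} {s} u∈U v∈U u⇝x z⇝v = oriented j
    where
    near-x = closest x u u∈U p (walkLen-reverse u⇝x)
    near-z = closest z v v∈U s z⇝v
    a₁ = proj₁ near-x
    a₂ = proj₁ near-z
    tx⇝x : WalkLen G (t x) x a₁
    tx⇝x = walkLen-reverse (proj₁ (proj₂ near-x))
    z⇝tz : WalkLen G z (t z) a₂
    z⇝tz = proj₁ (proj₂ near-z)
    detour : ∀ b → b ≤[ e ] a₁ ℕ.+ len G i ℕ.+ a₂ → b ≤[ e * e ] p ℕ.+ (len G i ℕ.+ s)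
    detour b = ≤[]-detour e 1≤e {a₁} {a₂} {len G i} {p} {s} {b} (proj₂ (proj₂ near-x)) (proj₂ (proj₂ near-z))
    oriented : Joins G i x z → Σ[ f ∈ Fin (m H) ] Joins H f (t x) (t z) × (len H f ≤[ e * e ] p ℕ.+ (len G i ℕ.+ s))
    oriented (inj₁ ixz) with edge-image i x z ixz
    ... | f , jf , f≤ = f , jf , detour (len H f) (f≤ a₁ a₂ tx⇝x z⇝tz)
    oriented (inj₂ izx) with edge-image i z x izx
    ... | f , jf , f≤ = f , joins-sym {g = H} jf ,
          detour (len H f) (subst (len H f ≤[ e ]_) (xy∙z≈zy∙x a₂ (len G i) a₁)
                                  (f≤ a₂ a₁ (walkLen-reverse z⇝tz) (walkLen-reverse tx⇝x)))

  light-walk : ∀ {T} → IsMST H U T → ∀ {P u v} → u ∈ U → v ∈ U → ∀ {x} (w : Walk G P x v) {p} → WalkLen G u x p →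
               Walk H (λ i → (i ∈ T) × (len H i ≤[ e * e ] p ℕ.+ walk-length w)) (t x) v
  light-walk mst u∈U v∈U ε _ = subst (λ y → Walk H _ y _) (sym (t-fixes-terminals v∈U)) ε
  light-walk {T} mst u∈U v∈U (via i _ j ◅ w) {p} u⇝x with image-edge j u∈U v∈U u⇝x (toWalkLen w)
  ... | f , jf , f≤ = walk-map light (cycle-property mst f jf)
                      ◅◅ walk-map regrouped (light-walk mst u∈U v∈U w (walkLen-++ u⇝x (cons i j nil)))
    where
    D = p ℕ.+ (len G i ℕ.+ walk-length w)
    light : ∀ {h} → Light T (len H f) h → (h ∈ T) × (len H h ≤[ e * e ] D)
    light {h} (h∈T , h≤f) = h∈T , ≤[]-monoˡ {e * e} {len H h} {len H f} {D} h≤f f≤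
    regroup : p ℕ.+ (len G i ℕ.+ 0) ℕ.+ walk-length w ≡ D
    regroup = trans (ℕP.+-assoc p _ _) (cong (λ l → p ℕ.+ (l ℕ.+ walk-length w)) (ℕP.+-identityʳ (len G i)))
    regrouped : ∀ {h} → (h ∈ T) × (len H h ≤[ e * e ] p ℕ.+ (len G i ℕ.+ 0) ℕ.+ walk-length w) →
                (h ∈ T) × (len H h ≤[ e * e ] D)
    regrouped {h} (h∈T , h≤) = h∈T , subst (len H h ≤[ e * e ]_) regroup h≤

  mst-vs-connector : ∀ {T} → IsMST H U T → ∀ {S} → Connects G (_∈ S) U →
                     weight H T ≤[ e * e ] weight G S ℕ.+ weight G S
  mst-vs-connector {T} mst {S} connS with ∣p∣≡1+k⇒Nonempty (sym (mst-size mst))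
  ... | r , r∈U = ≤[]-monoʳ (e * e) {weight H T} {weight (requests L) ⊤}
        (mst-bottleneck-bound _ H U endsH mst (requests L) refl ends covers connects)
        (subst (ℕ._≤ _) (sym (trans (weight-requests L) (proj₁ (proj₂ segments)))) (proj₁ (proj₂ closed-tour)))
    where
    open Segmentation G (_∈ S) U
    open TerminalWalk
    closed-tour = tour (suc ∣ S ∣) G S (ℕP.n<1+n _) r
    segments = segment r∈U (proj₁ closed-tour) r∈U ε λ _ → refl
    L = proj₁ segments
    ends : EndsIn (requests L) ⊤ U
    ends j _ = from∈U (List.lookup L j) , to∈U (List.lookup L j)
    covers : Covers H T (requests L) ⊤
    covers j _ = subst (λ y → Walk H (λ i → (i ∈ T) × (len H i ≤[ e * e ] walk-length (walk s))) y (to s))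
      (t-fixes-terminals (from∈U s)) (light-walk mst (from∈U s) (to∈U s) (walk s) nil)
      where s = List.lookup L j
    reach : ∀ x → x ∈ U → Walk (requests L) (_∈ ⊤) r x
    reach x x∈U = proj₂ (proj₂ segments) x x∈U (proj₂ (proj₂ closed-tour) x (connS r x r∈U x∈U))
    connects : Connects (requests L) (_∈ ⊤) U
    connects x y x∈U y∈U = walk-reverse (reach x x∈U) ◅◅ reach y y∈U

lemma4p4 :
    (ε : ℚ) → 0ℚ < ε →
    (n L : ℕ) (G : Graph n) → Simple G →
    (∀ e → (1 ℕ.≤ len G e) × (len G e ℕ.≤ L)) →
    (U : Subset n) →
    (H : Graph n) →
    (∀ f → (proj₁ (edge H f) ∈ U) × (proj₂ (edge H f) ∈ U)) →
    (∀ f → (1 ℕ.≤ len H f) × (len H f ℕ.≤ 2 ℕ.* n ℕ.* L)) →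
    (t : Fin n → Fin n) →
    (∀ x → t x ∈ U) →
    (∀ x u → u ∈ U → ∀ b → WalkLen G x u b →
       ∃[ a ] (WalkLen G x (t x) a × (ℕ→ℚ a ≤ (1ℚ + ε) * ℕ→ℚ b))) →
    (∀ e x y → edge G e ≡ (x , y) →
       ∃[ f ] (((edge H f ≡ (t x , t y)) ⊎ (edge H f ≡ (t y , t x))) ×
         (∀ d₁ d₂ → WalkLen G (t x) x d₁ → WalkLen G y (t y) d₂ →
            ℕ→ℚ (len H f) ≤ (1ℚ + ε) * ℕ→ℚ (d₁ ℕ.+ len G e ℕ.+ d₂)))) →
    ∀ T S Vs → IsMST H U T → IsMinSteinerTree G U S Vs →
    ℕ→ℚ (weight H T) ≤ ℕ→ℚ 2 * ((1ℚ + ε) * (1ℚ + ε)) * ℕ→ℚ (weight G S)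
lemma4p4 δ 0<δ n _ G _ lenG U H endsH _ t _ closest edge-image T S Vs mst ((_ , U⊆Vs , connS , _) , _) =
  ≤[]-double ((1ℚ + δ) * (1ℚ + δ)) (weight H T) (weight G S) (mst-vs-connector mst steiner-connects)
  where
  1≤1+δ : 1ℚ ≤ 1ℚ + δ
  1≤1+δ = subst (_≤ 1ℚ + δ) (ℚP.+-identityʳ 1ℚ) (ℚP.+-monoʳ-≤ 1ℚ (ℚP.<⇒≤ 0<δ))
  open TerminalMap (1ℚ + δ) 1≤1+δ G H U endsH (proj₁ ∘ lenG) t closest edge-image
  steiner-connects : Connects G (_∈ S) U
  steiner-connects x y x∈U y∈U = Conn⇒Walk (connS x y (U⊆Vs x x∈U) (U⊆Vs y y∈U))
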